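{- $\mathit{Th}_{\Delta^b_0(\alpha)}(\mathbb N)$ is not equivalent to a universal theory.
   Context: $\mathsf{PV}$ is the language with a binary relation symbol $<$ and a function symbol for every polynomial-time Turing machine, with standard model $\mathbb N$; $|x|=\lceil\log_2(x+1)\rceil$. $\alpha$ is a unary relation symbol. $\Delta^b_0(\alpha)$ is the set of $(\mathsf{PV}\cup\{\alpha\})$-formulas built from atomic formulas by Boolean connectives and sharply bounded quantifiers $\exists x{<}|t|,\forall x{<}|t|$ ($t$ a $\mathsf{PV}$-term not containing $x$). $\mathit{Th}_{\Delta^b_0(\alpha)}(\mathbb N)$ is the set of universal closures of $\Delta^b_0(\alpha)$-formulas true in $(\mathbb N,\alpha^{\mathbb N})$ for every $\alpha^{\mathbb N}\subseteq\mathbb N$; it is a theory in the language $\mathsf{PV}\cup\{\alpha\}$, and "universal theory" refers to a set of universal sentences in this language. -}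

module Defs where

open import Data.Nat using (ℕ; zero; suc; _+_; _*_; _^_; _<_)
open import Data.Nat.DivMod using (_/_; _%_)
open import Data.Nat.Logarithm using (⌈log₂_⌉)
open import Data.Bool using (Bool; true; false; if_then_else_)
open import Data.Fin using (Fin)
open import Data.List using (List; []; _∷_; _++_; length)
open import Data.Vec using (Vec; []; _∷_)
open import Data.Maybe using (Maybe; just; nothing; maybe′; Is-just)
open import Data.Product using (Σ; _×_; _,_)
open import Data.Empty using (⊥)
open import Data.Nat using (_≡ᵇ_)
open import Relation.Binary.PropositionalEquality using (_≡_)

data Sym : Set where
  b0 b1 sep blank : Sym

-- binary digits of n, least significant first; bits 0 = []
bitsAux : ℕ → ℕ → List Sym
bitsAux zero    n = []
bitsAux (suc f) n =
  if n ≡ᵇ 0 then [] else ((if (n % 2) ≡ᵇ 0 then b0 else b1) ∷ bitsAux f (n / 2))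

bits : ℕ → List Sym
bits n = bitsAux n n

encode : ∀ {k} → Vec ℕ k → List Sym
encode []       = []
encode (x ∷ xs) = bits x ++ (sep ∷ encode xs)

decode : List Sym → ℕ
decode (b0 ∷ s) = 2 * decode s
decode (b1 ∷ s) = suc (2 * decode s)
decode _        = 0

data Move : Set where
  left right stay : Move

-- single-tape deterministic Turing machine; δ q a = nothing means "halt"
record TM : Set where
  field
    Q     : ℕ
    start : Fin Q
    δ     : Fin Q → Sym → Maybe (Fin Q × Sym × Move)

-- configuration: state, tape left of head (reversed), tape from head on
Config : TM → Set
Config M = Fin (TM.Q M) × List Sym × List Sym

headSym : List Sym → Sym
headSym []      = blank
headSym (a ∷ _) = a

tailSym : List Sym → List Sym
tailSym []      = []
tailSym (_ ∷ r) = r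

moveHead : Move → Sym → List Sym → List Sym → List Sym × List Sym
moveHead left  s []      r = ([] , s ∷ tailSym r)
moveHead left  s (a ∷ l) r = (l , a ∷ s ∷ tailSym r)
moveHead right s l       r = (s ∷ l , tailSym r)
moveHead stay  s l       r = (l , s ∷ tailSym r)

run : (M : TM) → ℕ → Config M → Maybe (List Sym)
run M fuel (q , l , r) with TM.δ M q (headSym r)
... | nothing = just r
run M zero    (q , l , r) | just _ = nothing
run M (suc f) (q , l , r) | just (q' , s , m) with moveHead m s l r
... | (l' , r') = run M f (q' , l' , r')

initConfig : (M : TM) → ∀ {k} → Vec ℕ k → Config M
initConfig M xs = (TM.start M , [] , encode xs)

clock : ℕ → ℕ → ℕ → ℕ
clock c d n = c * (suc n) ^ d

PolyTime : (k : ℕ) → TM → ℕ → ℕ → Set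
PolyTime k M c d = (xs : Vec ℕ k) →
  Is-just (run M (clock c d (length (encode xs))) (initConfig M xs))

-- k-ary PV function symbols: polynomial-time Turing machines
record PVSym (k : ℕ) : Set where
  field
    machine : TM
    c d     : ℕ
    poly    : PolyTime k machine c d

interp : ∀ {k} → PVSym k → Vec ℕ k → ℕ
interp f xs = maybe′ decode 0
  (run M (clock (PVSym.c f) (PVSym.d f) (length (encode xs))) (initConfig M xs))
  where M = PVSym.machine f

-- Syntax of first-order logic over PV ∪ {<, α} (with equality), de Bruijn

data Term : Set where
  var : ℕ → Term
  app : ∀ {k} → PVSym k → Vec Term k → Term

infixr 5 _⇒_
infix 7 _≐_ _<'_

data Fm : Set where
  _≐_  : Term → Term → Fm
  _<'_ : Term → Term → Fm
  α'   : Term → Fm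
  ⊥'   : Fm
  _⇒_  : Fm → Fm → Fm
  ∀'   : Fm → Fm

¬' : Fm → Fm
¬' φ = φ ⇒ ⊥'

∃' : Fm → Fm
∃' φ = ¬' (∀' (¬' φ))

_∧'_ : Fm → Fm → Fm
φ ∧' ψ = ¬' (φ ⇒ ¬' ψ)

mutual
  substT : (ℕ → Term) → Term → Term
  substT σ (var i)    = σ i
  substT σ (app f ts) = app f (substV σ ts)

  substV : ∀ {k} → (ℕ → Term) → Vec Term k → Vec Term k
  substV σ []       = []
  substV σ (t ∷ ts) = substT σ t ∷ substV σ ts

shiftT : Term → Term
shiftT = substT (λ i → var (suc i))

liftσ : (ℕ → Term) → ℕ → Term
liftσ σ zero    = var zero
liftσ σ (suc i) = shiftT (σ i)

substF : (ℕ → Term) → Fm → Fm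
substF σ (t ≐ s)  = substT σ t ≐ substT σ s
substF σ (t <' s) = substT σ t <' substT σ s
substF σ (α' t)   = α' (substT σ t)
substF σ ⊥'       = ⊥'
substF σ (φ ⇒ ψ)  = substF σ φ ⇒ substF σ ψ
substF σ (∀' φ)   = ∀' (substF (liftσ σ) φ)

shiftF : Fm → Fm
shiftF = substF (λ i → var (suc i))

sub0 : Term → ℕ → Term
sub0 t zero    = t
sub0 t (suc i) = var i

subst0 : Term → Fm → Fm
subst0 t = substF (sub0 t)

mutual
  BelowT : ℕ → Term → Set
  BelowT n (var i)    = i < n
  BelowT n (app f ts) = BelowV n ts

  BelowV : ∀ {k} → ℕ → Vec Term k → Set
  BelowV n []       = Data.Unit.⊤
    where import Data.Unit
  BelowV n (t ∷ ts) = BelowT n t × BelowV n ts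

BelowF : ℕ → Fm → Set
BelowF n (t ≐ s)  = BelowT n t × BelowT n s
BelowF n (t <' s) = BelowT n t × BelowT n s
BelowF n (α' t)   = BelowT n t
BelowF n ⊥'       = Data.Unit.⊤
  where import Data.Unit
BelowF n (φ ⇒ ψ)  = BelowF n φ × BelowF n ψ
BelowF n (∀' φ)   = BelowF (suc n) φ

Sentence : Fm → Set
Sentence = BelowF 0

∀^ : ℕ → Fm → Fm
∀^ zero    φ = φ
∀^ (suc n) φ = ∀' (∀^ n φ)

extend : ℕ → (ℕ → ℕ) → ℕ → ℕ
extend d ρ zero    = d
extend d ρ (suc i) = ρ i

mutual
  evalT : (ℕ → ℕ) → Term → ℕ
  evalT ρ (var i)    = ρ i
  evalT ρ (app f ts) = interp f (evalV ρ ts)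

  evalV : ∀ {k} → (ℕ → ℕ) → Vec Term k → Vec ℕ k
  evalV ρ []       = []
  evalV ρ (t ∷ ts) = evalT ρ t ∷ evalV ρ ts

Sat : (ℕ → Bool) → (ℕ → ℕ) → Fm → Set
Sat α ρ (t ≐ s)  = evalT ρ t ≡ evalT ρ s
Sat α ρ (t <' s) = evalT ρ t < evalT ρ s
Sat α ρ (α' t)   = α (evalT ρ t) ≡ true
Sat α ρ ⊥'       = ⊥
Sat α ρ (φ ⇒ ψ)  = Sat α ρ φ → Sat α ρ ψ
Sat α ρ (∀' φ)   = (d : ℕ) → Sat α (extend d ρ) φ

IsLength : PVSym 1 → Set
IsLength f = (x : ℕ) → interp f (x ∷ []) ≡ ⌈log₂ (suc x) ⌉

data Δb0 : Fm → Set where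
  eq   : ∀ t s → Δb0 (t ≐ s)
  lt   : ∀ t s → Δb0 (t <' s)
  mem  : ∀ t → Δb0 (α' t)
  bot  : Δb0 ⊥'
  imp  : ∀ {φ ψ} → Δb0 φ → Δb0 ψ → Δb0 (φ ⇒ ψ)
  -- ∀x<|t| φ   (t does not contain the bound variable x = var 0)
  ball : ∀ {φ} (len : PVSym 1) → IsLength len → (t : Term) → Δb0 φ →
         Δb0 (∀' ((var 0 <' app len (shiftT t ∷ [])) ⇒ φ))
  bex  : ∀ {φ} (len : PVSym 1) → IsLength len → (t : Term) → Δb0 φ →
         Δb0 (∃' ((var 0 <' app len (shiftT t ∷ [])) ∧' φ))

record ThΔ (φ : Fm) : Set where
  field
    n     : ℕ
    ψ     : Fm
    isΔ   : Δb0 ψ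
    below : BelowF n ψ
    clos  : φ ≡ ∀^ n ψ
    holds : (α : ℕ → Bool) → Sat α (λ _ → 0) φ

data QF : Fm → Set where
  eq  : ∀ t s → QF (t ≐ s)
  lt  : ∀ t s → QF (t <' s)
  mem : ∀ t → QF (α' t)
  bot : QF ⊥'
  imp : ∀ {φ ψ} → QF φ → QF ψ → QF (φ ⇒ ψ)

UniversalSentence : Fm → Set
UniversalSentence φ =
  Σ ℕ λ n → Σ Fm λ θ → QF θ × BelowF n θ × (φ ≡ ∀^ n θ)

-- Classical first-order provability with equality (Hilbert style);
-- the hypotheses Γ are sentences

infix 4 _⊢_
data _⊢_ (Γ : Fm → Set) : Fm → Set where
  hyp   : ∀ {φ} → Γ φ → Γ ⊢ φ
  axK   : ∀ {φ ψ} → Γ ⊢ φ ⇒ (ψ ⇒ φ)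
  axS   : ∀ {φ ψ χ} → Γ ⊢ (φ ⇒ (ψ ⇒ χ)) ⇒ ((φ ⇒ ψ) ⇒ (φ ⇒ χ))
  axDN  : ∀ {φ} → Γ ⊢ ¬' (¬' φ) ⇒ φ
  mp    : ∀ {φ ψ} → Γ ⊢ φ ⇒ ψ → Γ ⊢ φ → Γ ⊢ ψ
  axIn  : ∀ {φ} (t : Term) → Γ ⊢ ∀' φ ⇒ subst0 t φ
  axQ   : ∀ {φ ψ} → Γ ⊢ ∀' (shiftF φ ⇒ ψ) ⇒ (φ ⇒ ∀' ψ)
  gen   : ∀ {φ} → Γ ⊢ φ → Γ ⊢ ∀' φ
  axRef : (t : Term) → Γ ⊢ t ≐ t
  axEq  : ∀ {φ} (t s : Term) → Γ ⊢ (t ≐ s) ⇒ (subst0 t φ ⇒ subst0 s φ)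

Equivalent : (Fm → Set) → (Fm → Set) → Set
Equivalent T T' = ((φ : Fm) → T φ → T' ⊢ φ) × ((φ : Fm) → T' φ → T ⊢ φ)

module Submission where

-- Force with conditions that are non-small families of sets of positions
-- k < |y|, where a family is small if for all large y it has boundedly many
-- positions below |y|. Elements of the generic model are functions f : ℕ → ℕ,
-- evaluated at y, and at position (y, k) the generic α is {x : x ≤ k}.
-- Forcing is sound for provability, and a universal sentence true in every
-- (ℕ, α) is forced because it holds at every position. So if Th_Δ were
-- equivalent to a universal theory, everything that theory proves, in
-- particular every member of Th_Δ, would be forced. But the maximum principle
-- "a nonempty α ∩ [0, |y|) has a largest element" is not: for y the identity
-- and the least element 0, a maximum would be a function f with f(y) = k at
-- almost all positions (y, k) of a condition, while the graph of f has at most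
-- one position below each |y|. The length function |·| in that principle is
-- realised by an explicit polynomial-time Turing machine.

open import Defs
open import Data.Nat
  using (ℕ; zero; suc; _+_; _*_; _≤_; _<_; z≤n; s≤s; _⊔_; _^_; _≟_; _<?_; _≡ᵇ_; _<ᵇ_; _≤ᵇ_; ⌊_/2⌋)
open import Data.Nat.Properties
open import Data.Nat.DivMod using (_/_; _%_; m/n≡1+[m∸n]/n; m/n<m)
open import Data.Nat.Logarithm using (⌈log₂_⌉; ⌈log₂⌉-mono-≤; ⌈log₂2^n⌉≡n)
open import Data.Nat.Logarithm.Core using (⌈log2⌉-acc-irrelevant)
open import Data.Nat.Tactic.RingSolver using (solve-∀)
open import Data.Bool using (Bool; true; false; T; not; _∧_; _∨_; if_then_else_)
open import Data.Bool.Properties using (T-≡)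
open import Data.Fin using (Fin; zero; suc)
open import Data.List using (List; []; _∷_; _++_; _ʳ++_; length)
open import Data.List.Properties using (ʳ++-ʳ++; length-ʳ++; length-++)
open import Data.List.Relation.Unary.All as All using (All; []; _∷_)
open import Data.Maybe using (Maybe; just; nothing; maybe′; Is-just)
open import Data.Maybe.Relation.Unary.Any using (just)
open import Data.Product using (Σ; _×_; _,_)
open import Data.Sum using (inj₁; inj₂)
open import Data.Unit using (tt)
open import Data.Vec using (Vec; []; _∷_)
open import Data.Empty using (⊥; ⊥-elim)
open import Function.Bundles using (Equivalence)
open import Relation.Nullary using (¬_; yes; no)
open import Relation.Binary.PropositionalEquality
  using (_≡_; refl; sym; trans; cong; cong₂; subst; subst₂; _≗_; module ≡-Reasoning)

mutual
  evalT-cong : ∀ {ρ ρ'} → ρ ≗ ρ' → ∀ t → evalT ρ t ≡ evalT ρ' t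
  evalT-cong e (var i)    = e i
  evalT-cong e (app f ts) = cong (interp f) (evalV-cong e ts)

  evalV-cong : ∀ {ρ ρ' k} → ρ ≗ ρ' → (ts : Vec Term k) → evalV ρ ts ≡ evalV ρ' ts
  evalV-cong e []       = refl
  evalV-cong e (t ∷ ts) = cong₂ _∷_ (evalT-cong e t) (evalV-cong e ts)

mutual
  evalT-below : ∀ {n ρ ρ'} → (∀ i → i < n → ρ i ≡ ρ' i) →
                ∀ t → BelowT n t → evalT ρ t ≡ evalT ρ' t
  evalT-below e (var i)    b = e i b
  evalT-below e (app f ts) b = cong (interp f) (evalV-below e ts b)

  evalV-below : ∀ {n ρ ρ' k} → (∀ i → i < n → ρ i ≡ ρ' i) →
                (ts : Vec Term k) → BelowV n ts → evalV ρ ts ≡ evalV ρ' ts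
  evalV-below e []       _        = refl
  evalV-below e (t ∷ ts) (bt , bs) = cong₂ _∷_ (evalT-below e t bt) (evalV-below e ts bs)

mutual
  evalT-substT : ∀ ρ σ t → evalT ρ (substT σ t) ≡ evalT (λ i → evalT ρ (σ i)) t
  evalT-substT ρ σ (var i)    = refl
  evalT-substT ρ σ (app f ts) = cong (interp f) (evalV-substV ρ σ ts)

  evalV-substV : ∀ {k} ρ σ (ts : Vec Term k) →
                 evalV ρ (substV σ ts) ≡ evalV (λ i → evalT ρ (σ i)) ts
  evalV-substV ρ σ []       = refl
  evalV-substV ρ σ (t ∷ ts) = cong₂ _∷_ (evalT-substT ρ σ t) (evalV-substV ρ σ ts)

evalT-shiftT : ∀ d ρ t → evalT (extend d ρ) (shiftT t) ≡ evalT ρ t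
evalT-shiftT d ρ t = evalT-substT (extend d ρ) (λ i → var (suc i)) t

evalT-liftσ : ∀ d ρ σ → (λ i → evalT (extend d ρ) (liftσ σ i)) ≗ extend d (λ i → evalT ρ (σ i))
evalT-liftσ d ρ σ zero    = refl
evalT-liftσ d ρ σ (suc i) = evalT-shiftT d ρ (σ i)

evalT-sub0 : ∀ ρ t → (λ i → evalT ρ (sub0 t i)) ≗ extend (evalT ρ t) ρ
evalT-sub0 ρ t zero    = refl
evalT-sub0 ρ t (suc i) = refl

module _ (α : ℕ → Bool) where

  Sat-cong : ∀ {ρ ρ'} → ρ ≗ ρ' → ∀ φ → Sat α ρ φ → Sat α ρ' φ
  Sat-cong e (t ≐ s)  h = trans (sym (evalT-cong e t)) (trans h (evalT-cong e s))
  Sat-cong e (t <' s) h = subst₂ _<_ (evalT-cong e t) (evalT-cong e s) h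
  Sat-cong e (α' t)   h = trans (cong α (sym (evalT-cong e t))) h
  Sat-cong e ⊥'       h = h
  Sat-cong e (φ ⇒ ψ)  h x = Sat-cong e ψ (h (Sat-cong (λ i → sym (e i)) φ x))
  Sat-cong e (∀' φ)   h d = Sat-cong (λ { zero → refl ; (suc i) → e i }) φ (h d)

  Sat-below : ∀ {n ρ ρ'} → (∀ i → i < n → ρ i ≡ ρ' i) →
              ∀ φ → BelowF n φ → Sat α ρ φ → Sat α ρ' φ
  Sat-below e (t ≐ s)  (bt , bs) h = trans (sym (evalT-below e t bt)) (trans h (evalT-below e s bs))
  Sat-below e (t <' s) (bt , bs) h = subst₂ _<_ (evalT-below e t bt) (evalT-below e s bs) h
  Sat-below e (α' t)   b         h = trans (cong α (sym (evalT-below e t b))) h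
  Sat-below e ⊥'       _         h = h
  Sat-below e (φ ⇒ ψ)  (bφ , bψ) h x =
    Sat-below e ψ bψ (h (Sat-below (λ i i<n → sym (e i i<n)) φ bφ x))
  Sat-below e (∀' φ)   b         h d =
    Sat-below (λ { zero _ → refl ; (suc i) (s≤s i<n) → e i i<n }) φ b (h d)

  mutual
    Sat-substF⁻ : ∀ ρ σ φ → Sat α ρ (substF σ φ) → Sat α (λ i → evalT ρ (σ i)) φ
    Sat-substF⁻ ρ σ (t ≐ s)  h = trans (sym (evalT-substT ρ σ t)) (trans h (evalT-substT ρ σ s))
    Sat-substF⁻ ρ σ (t <' s) h = subst₂ _<_ (evalT-substT ρ σ t) (evalT-substT ρ σ s) h
    Sat-substF⁻ ρ σ (α' t)   h = trans (cong α (sym (evalT-substT ρ σ t))) h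
    Sat-substF⁻ ρ σ ⊥'       h = h
    Sat-substF⁻ ρ σ (φ ⇒ ψ)  h x = Sat-substF⁻ ρ σ ψ (h (Sat-substF⁺ ρ σ φ x))
    Sat-substF⁻ ρ σ (∀' φ)   h d =
      Sat-cong (evalT-liftσ d ρ σ) φ (Sat-substF⁻ (extend d ρ) (liftσ σ) φ (h d))

    Sat-substF⁺ : ∀ ρ σ φ → Sat α (λ i → evalT ρ (σ i)) φ → Sat α ρ (substF σ φ)
    Sat-substF⁺ ρ σ (t ≐ s)  h = trans (evalT-substT ρ σ t) (trans h (sym (evalT-substT ρ σ s)))
    Sat-substF⁺ ρ σ (t <' s) h = subst₂ _<_ (sym (evalT-substT ρ σ t)) (sym (evalT-substT ρ σ s)) h
    Sat-substF⁺ ρ σ (α' t)   h = trans (cong α (evalT-substT ρ σ t)) h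
    Sat-substF⁺ ρ σ ⊥'       h = h
    Sat-substF⁺ ρ σ (φ ⇒ ψ)  h x = Sat-substF⁺ ρ σ ψ (h (Sat-substF⁻ ρ σ φ x))
    Sat-substF⁺ ρ σ (∀' φ)   h d =
      Sat-substF⁺ (extend d ρ) (liftσ σ) φ (Sat-cong (λ i → sym (evalT-liftσ d ρ σ i)) φ (h d))

  Sat-¬¬-stable : ∀ ρ φ → ¬ ¬ Sat α ρ φ → Sat α ρ φ
  Sat-¬¬-stable ρ (t ≐ s) h with evalT ρ t ≟ evalT ρ s
  ... | yes p = p
  ... | no ¬p = ⊥-elim (h ¬p)
  Sat-¬¬-stable ρ (t <' s) h with evalT ρ t <? evalT ρ s
  ... | yes p = p
  ... | no ¬p = ⊥-elim (h ¬p)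
  Sat-¬¬-stable ρ (α' t) h with α (evalT ρ t)
  ... | true  = refl
  ... | false = ⊥-elim (h λ ())
  Sat-¬¬-stable ρ ⊥'      h = h (λ x → x)
  Sat-¬¬-stable ρ (φ ⇒ ψ) h x = Sat-¬¬-stable ρ ψ λ ¬ψ → h λ f → ¬ψ (f x)
  Sat-¬¬-stable ρ (∀' φ)  h d = Sat-¬¬-stable (extend d ρ) φ λ ¬φ → h λ f → ¬φ (f d)

  Valid : Fm → Set
  Valid φ = ∀ ρ → Sat α ρ φ

  ⊢-sound : ∀ {Γ φ} → (∀ ψ → Γ ψ → Valid ψ) → Γ ⊢ φ → Valid φ
  ⊢-sound H (hyp Γψ)          ρ = H _ Γψ ρ
  ⊢-sound H axK               ρ x _ = x
  ⊢-sound H axS               ρ f g x = f x (g x)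
  ⊢-sound H (axDN {φ})        ρ = Sat-¬¬-stable ρ φ
  ⊢-sound H (mp d e)          ρ = ⊢-sound H d ρ (⊢-sound H e ρ)
  ⊢-sound H (axIn {φ} t)      ρ h =
    Sat-substF⁺ ρ (sub0 t) φ (Sat-cong (λ i → sym (evalT-sub0 ρ t i)) φ (h (evalT ρ t)))
  ⊢-sound H (axQ {φ})         ρ h x d =
    h d (Sat-substF⁺ (extend d ρ) (λ i → var (suc i)) φ x)
  ⊢-sound H (gen d)           ρ e = ⊢-sound H d (extend e ρ)
  ⊢-sound H (axRef t)         ρ = refl
  ⊢-sound H (axEq {φ} t s)    ρ t≡s x =
    Sat-substF⁺ ρ (sub0 s) φ
      (Sat-cong (λ { zero → t≡s ; (suc i) → refl }) φ (Sat-substF⁻ ρ (sub0 t) φ x))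

BelowF-∀^ : ∀ m n φ → BelowF (m + n) φ → BelowF m (∀^ n φ)
BelowF-∀^ m zero    φ b = subst (λ k → BelowF k φ) (+-identityʳ m) b
BelowF-∀^ m (suc n) φ b = BelowF-∀^ (suc m) n φ (subst (λ k → BelowF k φ) (+-suc m n) b)

ThΔ-valid : ∀ α φ → ThΔ φ → Valid α φ
ThΔ-valid α φ th ρ = Sat-below α (λ _ ()) φ closed (ThΔ.holds th α)
  where
  open ThΔ th using (n; ψ; below; clos)
  closed : Sentence φ
  closed = subst Sentence (sym clos) (BelowF-∀^ 0 n ψ below)

-- Small families

count : ℕ → (ℕ → Bool) → ℕ
count zero    P = 0
count (suc n) P = (if P n then 1 else 0) + count n P

count-mono : ∀ n {P Q : ℕ → Bool} → (∀ k → k < n → T (P k) → T (Q k)) →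
             count n P ≤ count n Q
count-mono zero    h = z≤n
count-mono (suc n) {P} {Q} h with P n | Q n | h n ≤-refl
... | true  | true  | _   = s≤s (count-mono n (λ k k<n → h k (m≤n⇒m≤1+n k<n)))
... | true  | false | Qn  = ⊥-elim (Qn tt)
... | false | true  | _   = m≤n⇒m≤1+n (count-mono n (λ k k<n → h k (m≤n⇒m≤1+n k<n)))
... | false | false | _   = count-mono n (λ k k<n → h k (m≤n⇒m≤1+n k<n))

count-none : ∀ n {P : ℕ → Bool} → (∀ k → k < n → ¬ T (P k)) → count n P ≡ 0
count-none zero    h = refl
count-none (suc n) {P} h with P n | h n ≤-refl
... | true  | ¬Pn = ⊥-elim (¬Pn tt)
... | false | _   = count-none n (λ k k<n → h k (m≤n⇒m≤1+n k<n))

count-all : ∀ n → count n (λ _ → true) ≡ n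
count-all zero    = refl
count-all (suc n) = cong suc (count-all n)

count-∨ : ∀ n (P Q : ℕ → Bool) → count n (λ k → P k ∨ Q k) ≤ count n P + count n Q
count-∨ zero    P Q = z≤n
count-∨ (suc n) P Q with P n | Q n
... | true  | true  = s≤s (≤-trans (count-∨ n P Q) (≤-trans (n≤1+n _) (≤-reflexive (sym (+-suc _ _)))))
... | true  | false = s≤s (count-∨ n P Q)
... | false | true  = ≤-trans (s≤s (count-∨ n P Q)) (≤-reflexive (sym (+-suc _ _)))
... | false | false = count-∨ n P Q

count-≡ᵇ : ∀ n a → count n (a ≡ᵇ_) ≤ 1
count-≡ᵇ zero    a = z≤n
count-≡ᵇ (suc n) a with a ≡ᵇ n | ≡ᵇ⇒≡ a n
... | false | _   = count-≡ᵇ n a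
... | true  | a≡n = s≤s (≤-reflexive (count-none n λ k k<n a≡k →
                      <-irrefl (trans (sym (≡ᵇ⇒≡ a k a≡k)) (a≡n tt)) k<n))

size : ℕ → ℕ
size y = ⌈log₂ suc y ⌉

Family : Set
Family = ℕ → ℕ → Bool

Small : Family → Set
Small A = Σ ℕ λ m → Σ ℕ λ n → ∀ y → n ≤ y → count (size y) (A y) ≤ m

infix 4 _⊆_
_⊆_ : Family → Family → Set
A ⊆ B = ∀ y k → k < size y → T (A y k) → T (B y k)

_∪_ : Family → Family → Family
(A ∪ B) y k = A y k ∨ B y k

Small-⊆ : ∀ {A B} → A ⊆ B → Small B → Small A
Small-⊆ {A} {B} A⊆B (m , n , s) =
  m , n , λ y n≤y → ≤-trans (count-mono (size y) (A⊆B y)) (s y n≤y)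

Small-∪ : ∀ {A B} → Small A → Small B → Small (A ∪ B)
Small-∪ {A} {B} (m₁ , n₁ , s₁) (m₂ , n₂ , s₂) = m₁ + m₂ , n₁ ⊔ n₂ , λ y n≤y →
  ≤-trans (count-∨ (size y) (A y) (B y))
          (+-mono-≤ (s₁ y (≤-trans (m≤m⊔n n₁ n₂) n≤y)) (s₂ y (≤-trans (m≤n⊔m n₁ n₂) n≤y)))

Small-empty : ∀ {A} → (∀ y k → k < size y → ¬ T (A y k)) → Small A
Small-empty h = 0 , 0 , λ y _ → ≤-reflexive (count-none (size y) (h y))

Small-graph : (f : ℕ → ℕ) → Small (λ y k → f y ≡ᵇ k)
Small-graph f = 1 , 0 , λ y _ → count-≡ᵇ (size y) (f y)

¬Small-full : ¬ Small (λ _ _ → true)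
¬Small-full (m , n , s) = n≮n m (begin-strict
  m                        <⟨ n<1+n m ⟩
  suc m                    ≡⟨ sym (⌈log₂2^n⌉≡n (suc m)) ⟩
  ⌈log₂ 2 ^ suc m ⌉        ≤⟨ ⌈log₂⌉-mono-≤ (≤-trans (m≤n+m _ n) (n≤1+n _)) ⟩
  size y                   ≡⟨ sym (count-all (size y)) ⟩
  count (size y) (λ _ → true) ≤⟨ s y (m≤m+n n _) ⟩
  m                        ∎)
  where
  open ≤-Reasoning
  y = n + 2 ^ suc m

-- Forcing

record Condition : Set where
  constructor condition
  field
    family : Family
    large  : ¬ Small family
open Condition

infix 4 _≼_
record _≼_ (q p : Condition) : Set where
  constructor extends
  field ⊆-family : family q ⊆ family p

≼-refl : ∀ {p} → p ≼ p
≼-refl = extends λ _ _ _ x → x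

≼-trans : ∀ {r q p} → r ≼ q → q ≼ p → r ≼ p
≼-trans (extends r⊆q) (extends q⊆p) = extends λ y k k< x → q⊆p y k k< (r⊆q y k k< x)

_∖_ : Family → Family → Family
(A ∖ B) y k = A y k ∧ not (B y k)

∁ : Family → Family
∁ A y k = not (A y k)

-- Double negation makes forcing of atoms stable under ¬¬ in this constructive
-- metatheory, as axDN requires.
infix 4 _⊩ₐ_
record _⊩ₐ_ (p : Condition) (S : Family) : Set where
  constructor forcesₐ
  field almost-⊆ : ¬ ¬ Small (family p ∖ S)

private
  ∖-split : ∀ a s₁ s₂ s → (T s₁ → T s₂ → T s) →
            T (a ∧ not s) → T ((a ∧ not s₁) ∨ (a ∧ not s₂))
  ∖-split true false _     false _ _ = tt
  ∖-split true true  false false _ _ = tt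
  ∖-split true true  true  false h _ = h tt tt
  ∖-split true _     _     true  _ ()
  ∖-split false _    _     _     _ ()

  ∖-mono : ∀ a b s → (T a → T b) → T (a ∧ not s) → T (b ∧ not s)
  ∖-mono true  true  s h x = x
  ∖-mono true  false s h x = h tt
  ∖-mono false b     s h ()

  ∖-empty : ∀ a s → (T a → T s) → ¬ T (a ∧ not s)
  ∖-empty true  true  h ()
  ∖-empty true  false h x = h tt
  ∖-empty false s     h ()

  ∖-∪ : ∀ a s → T a → T ((a ∧ not s) ∨ s)
  ∖-∪ true true  _ = tt
  ∖-∪ true false _ = tt

  ∖-⊆ˡ : ∀ a s → T (a ∧ not s) → T a
  ∖-⊆ˡ true _ _ = tt

  ∖-⊆ʳ : ∀ a s → T (a ∧ not s) → T (not s)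
  ∖-⊆ʳ true false _ = tt

⊩ₐ-≼ : ∀ {p q S} → q ≼ p → p ⊩ₐ S → q ⊩ₐ S
⊩ₐ-≼ {p} {q} {S} (extends q⊆p) (forcesₐ p⊩S) = forcesₐ λ ¬small → p⊩S λ s → ¬small (Small-⊆ sub s)
  where
  sub : family q ∖ S ⊆ family p ∖ S
  sub y k k< = ∖-mono (family q y k) (family p y k) (S y k) (q⊆p y k k<)

⊩ₐ-⊆ : ∀ {p S} → family p ⊆ S → p ⊩ₐ S
⊩ₐ-⊆ {p} {S} p⊆S = forcesₐ λ ¬small →
  ¬small (Small-empty λ y k k< → ∖-empty (family p y k) (S y k) (p⊆S y k k<))

⊩ₐ-∩ : ∀ {p S₁ S₂ S} → (∀ y k → k < size y → T (S₁ y k) → T (S₂ y k) → T (S y k)) →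
       p ⊩ₐ S₁ → p ⊩ₐ S₂ → p ⊩ₐ S
⊩ₐ-∩ {p} {S₁} {S₂} {S} h (forcesₐ p⊩S₁) (forcesₐ p⊩S₂) = forcesₐ λ ¬small →
  p⊩S₁ λ s₁ → p⊩S₂ λ s₂ → ¬small (Small-⊆ sub (Small-∪ s₁ s₂))
  where
  sub : family p ∖ S ⊆ (family p ∖ S₁) ∪ (family p ∖ S₂)
  sub y k k< = ∖-split (family p y k) (S₁ y k) (S₂ y k) (S y k) (h y k k<)

⊩ₐ-mono : ∀ {p S S'} → S ⊆ S' → p ⊩ₐ S → p ⊩ₐ S'
⊩ₐ-mono S⊆S' p⊩S = ⊩ₐ-∩ (λ y k k< x _ → S⊆S' y k k< x) p⊩S p⊩S

⊩ₐ-Small : ∀ {p S} → Small S → ¬ (p ⊩ₐ S)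
⊩ₐ-Small {p} {S} small (forcesₐ p⊩S) = p⊩S λ s → large p (Small-⊆ sub (Small-∪ s small))
  where
  sub : family p ⊆ (family p ∖ S) ∪ S
  sub y k _ = ∖-∪ (family p y k) (S y k)

⊩ₐ-∁ : ∀ {p S} → family p ⊆ ∁ S → ¬ (p ⊩ₐ S)
⊩ₐ-∁ {p} {S} p⊆∁S p⊩S =
  ⊩ₐ-Small (Small-empty λ _ _ _ ()) (⊩ₐ-∩ contradict p⊩S (⊩ₐ-⊆ p⊆∁S))
  where
  contradict : ∀ y k → k < size y → T (S y k) → T (∁ S y k) → ⊥
  contradict y k _ with S y k
  ... | true  = λ _ ()
  ... | false = λ ()

⊩ₐ-dense : ∀ {p S} → (∀ q → q ≼ p → family q ⊆ ∁ S → ⊥) → p ⊩ₐ S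
⊩ₐ-dense {p} {S} h = forcesₐ λ ¬small → h (condition (family p ∖ S) ¬small) (extends ∖⊆) ∖⊆∁
  where
  ∖⊆ : family p ∖ S ⊆ family p
  ∖⊆ y k _ = ∖-⊆ˡ (family p y k) (S y k)
  ∖⊆∁ : family p ∖ S ⊆ ∁ S
  ∖⊆∁ y k _ = ∖-⊆ʳ (family p y k) (S y k)

⊩ₐ-≗ : ∀ {p S S'} → (∀ y k → S y k ≡ S' y k) → p ⊩ₐ S → p ⊩ₐ S'
⊩ₐ-≗ S≗S' = ⊩ₐ-mono λ y k _ → subst T (S≗S' y k)

evalQF : (ℕ → Bool) → (ℕ → ℕ) → ∀ {θ} → QF θ → Bool
evalQF α ρ (eq t s)  = evalT ρ t ≡ᵇ evalT ρ s
evalQF α ρ (lt t s)  = evalT ρ t <ᵇ evalT ρ s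
evalQF α ρ (mem t)   = α (evalT ρ t)
evalQF α ρ bot       = false
evalQF α ρ (imp a b) = not (evalQF α ρ a) ∨ evalQF α ρ b

evalQF-cong : ∀ α {ρ ρ' θ} → ρ ≗ ρ' → (q : QF θ) → evalQF α ρ q ≡ evalQF α ρ' q
evalQF-cong α e (eq t s)  = cong₂ _≡ᵇ_ (evalT-cong e t) (evalT-cong e s)
evalQF-cong α e (lt t s)  = cong₂ _<ᵇ_ (evalT-cong e t) (evalT-cong e s)
evalQF-cong α e (mem t)   = cong α (evalT-cong e t)
evalQF-cong α e bot       = refl
evalQF-cong α e (imp a b) = cong₂ (λ u v → not u ∨ v) (evalQF-cong α e a) (evalQF-cong α e b)

mutual
  Sat→evalQF : ∀ α ρ {θ} (q : QF θ) → Sat α ρ θ → T (evalQF α ρ q)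
  Sat→evalQF α ρ (eq t s)  h = ≡⇒≡ᵇ _ _ h
  Sat→evalQF α ρ (lt t s)  h = <⇒<ᵇ h
  Sat→evalQF α ρ (mem t)   h = Equivalence.from T-≡ h
  Sat→evalQF α ρ (imp a b) h with evalQF α ρ a | evalQF→Sat α ρ a
  ... | false | _    = tt
  ... | true  | satA = Sat→evalQF α ρ b (h (satA tt))

  evalQF→Sat : ∀ α ρ {θ} (q : QF θ) → T (evalQF α ρ q) → Sat α ρ θ
  evalQF→Sat α ρ (eq t s)  h = ≡ᵇ⇒≡ _ _ h
  evalQF→Sat α ρ (lt t s)  h = <ᵇ⇒< _ _ h
  evalQF→Sat α ρ (mem t)   h = Equivalence.to T-≡ h
  evalQF→Sat α ρ (imp a b) h x with evalQF α ρ a | Sat→evalQF α ρ a x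
  ... | true | _ = evalQF→Sat α ρ b h

Env : Set
Env = ℕ → ℕ → ℕ

_∷ᴱ_ : (ℕ → ℕ) → Env → Env
(f ∷ᴱ ρ) y = extend (f y) (ρ y)

genericα : ℕ → ℕ → Bool
genericα k x = x ≤ᵇ k

holds : Env → ∀ {θ} → QF θ → Family
holds ρ q y k = evalQF (genericα k) (ρ y) q

Forces : Condition → Env → Fm → Set
Forces p ρ (t ≐ s)  = p ⊩ₐ holds ρ (eq t s)
Forces p ρ (t <' s) = p ⊩ₐ holds ρ (lt t s)
Forces p ρ (α' t)   = p ⊩ₐ holds ρ (mem t)
Forces p ρ ⊥'       = ⊥
Forces p ρ (φ ⇒ ψ)  = ∀ q → q ≼ p → Forces q ρ φ → Forces q ρ ψ
Forces p ρ (∀' φ)   = ∀ f → Forces p (f ∷ᴱ ρ) φ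

Forces-≼ : ∀ {p q} ρ φ → q ≼ p → Forces p ρ φ → Forces q ρ φ
Forces-≼ ρ (t ≐ s)  q≼p = ⊩ₐ-≼ q≼p
Forces-≼ ρ (t <' s) q≼p = ⊩ₐ-≼ q≼p
Forces-≼ ρ (α' t)   q≼p = ⊩ₐ-≼ q≼p
Forces-≼ ρ ⊥'       q≼p h = h
Forces-≼ ρ (φ ⇒ ψ)  q≼p h r r≼q = h r (≼-trans r≼q q≼p)
Forces-≼ ρ (∀' φ)   q≼p h f = Forces-≼ (f ∷ᴱ ρ) φ q≼p (h f)

⊩ₐ-¬¬-stable : ∀ {p S} → (∀ q → q ≼ p → ¬ (∀ r → r ≼ q → ¬ r ⊩ₐ S)) → p ⊩ₐ S
⊩ₐ-¬¬-stable h = ⊩ₐ-dense λ q q≼p q⊆∁S →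
  h q q≼p λ r (extends r⊆q) → ⊩ₐ-∁ λ y k k< x → q⊆∁S y k k< (r⊆q y k k< x)

Forces-¬¬-stable : ∀ p ρ φ → Forces p ρ (¬' (¬' φ)) → Forces p ρ φ
Forces-¬¬-stable p ρ (t ≐ s)  h = ⊩ₐ-¬¬-stable h
Forces-¬¬-stable p ρ (t <' s) h = ⊩ₐ-¬¬-stable h
Forces-¬¬-stable p ρ (α' t)   h = ⊩ₐ-¬¬-stable h
Forces-¬¬-stable p ρ ⊥'       h = h p ≼-refl λ _ _ x → x
Forces-¬¬-stable p ρ (φ ⇒ ψ)  h q q≼p x = Forces-¬¬-stable q ρ ψ λ r r≼q ¬ψ →
  h r (≼-trans r≼q q≼p) λ s s≼r φ⇒ψ →
    ¬ψ s s≼r (φ⇒ψ s ≼-refl (Forces-≼ ρ φ (≼-trans s≼r r≼q) x))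
Forces-¬¬-stable p ρ (∀' φ)   h f = Forces-¬¬-stable p (f ∷ᴱ ρ) φ λ q q≼p ¬φ →
  h q q≼p λ r r≼q ∀φ → ¬φ r r≼q (∀φ f)

Agree : Family → Env → Env → Set
Agree D ρ ρ' = ∀ y k → T (D y k) → ρ y ≗ ρ' y

⊩ₐ-holds-agree : ∀ {p D ρ ρ' θ} (q : QF θ) → p ⊩ₐ D → Agree D ρ ρ' →
                 p ⊩ₐ holds ρ q → p ⊩ₐ holds ρ' q
⊩ₐ-holds-agree q p⊩D ag p⊩ρ =
  ⊩ₐ-∩ (λ y k _ x d → subst T (evalQF-cong (genericα k) (ag y k d) q) x) p⊩ρ p⊩D

Forces-agree : ∀ {p D ρ ρ'} φ → p ⊩ₐ D → Agree D ρ ρ' → Forces p ρ φ → Forces p ρ' φ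
Forces-agree (t ≐ s)  p⊩D ag = ⊩ₐ-holds-agree (eq t s) p⊩D ag
Forces-agree (t <' s) p⊩D ag = ⊩ₐ-holds-agree (lt t s) p⊩D ag
Forces-agree (α' t)   p⊩D ag = ⊩ₐ-holds-agree (mem t) p⊩D ag
Forces-agree ⊥'       p⊩D ag h = h
Forces-agree {D = D} {ρ} {ρ'} (φ ⇒ ψ) p⊩D ag h q q≼p x =
  Forces-agree ψ (⊩ₐ-≼ q≼p p⊩D) ag (h q q≼p (Forces-agree φ (⊩ₐ-≼ q≼p p⊩D) ag⁻¹ x))
  where
  ag⁻¹ : Agree D ρ' ρ
  ag⁻¹ y k d i = sym (ag y k d i)
Forces-agree {D = D} {ρ} {ρ'} (∀' φ) p⊩D ag h f = Forces-agree φ p⊩D ag∷ (h f)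
  where
  ag∷ : Agree D (f ∷ᴱ ρ) (f ∷ᴱ ρ')
  ag∷ y k d zero    = refl
  ag∷ y k d (suc i) = ag y k d i

Forces-cong : ∀ {p ρ ρ'} φ → (∀ y → ρ y ≗ ρ' y) → Forces p ρ φ → Forces p ρ' φ
Forces-cong φ e = Forces-agree {D = λ _ _ → true} φ (⊩ₐ-⊆ λ _ _ _ _ → tt) (λ y _ _ → e y)

substᴱ : Env → (ℕ → Term) → Env
substᴱ ρ σ y i = evalT (ρ y) (σ i)

mutual
  Forces-substF⁻ : ∀ p ρ σ φ → Forces p ρ (substF σ φ) → Forces p (substᴱ ρ σ) φ
  Forces-substF⁻ p ρ σ (t ≐ s)  = ⊩ₐ-≗ λ y k →
    cong₂ _≡ᵇ_ (evalT-substT (ρ y) σ t) (evalT-substT (ρ y) σ s)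
  Forces-substF⁻ p ρ σ (t <' s) = ⊩ₐ-≗ λ y k →
    cong₂ _<ᵇ_ (evalT-substT (ρ y) σ t) (evalT-substT (ρ y) σ s)
  Forces-substF⁻ p ρ σ (α' t)   = ⊩ₐ-≗ λ y k → cong (genericα k) (evalT-substT (ρ y) σ t)
  Forces-substF⁻ p ρ σ ⊥'       h = h
  Forces-substF⁻ p ρ σ (φ ⇒ ψ)  h q q≼p x = Forces-substF⁻ q ρ σ ψ (h q q≼p (Forces-substF⁺ q ρ σ φ x))
  Forces-substF⁻ p ρ σ (∀' φ)   h f =
    Forces-cong φ (λ y → evalT-liftσ (f y) (ρ y) σ) (Forces-substF⁻ p (f ∷ᴱ ρ) (liftσ σ) φ (h f))

  Forces-substF⁺ : ∀ p ρ σ φ → Forces p (substᴱ ρ σ) φ → Forces p ρ (substF σ φ)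
  Forces-substF⁺ p ρ σ (t ≐ s)  = ⊩ₐ-≗ λ y k →
    sym (cong₂ _≡ᵇ_ (evalT-substT (ρ y) σ t) (evalT-substT (ρ y) σ s))
  Forces-substF⁺ p ρ σ (t <' s) = ⊩ₐ-≗ λ y k →
    sym (cong₂ _<ᵇ_ (evalT-substT (ρ y) σ t) (evalT-substT (ρ y) σ s))
  Forces-substF⁺ p ρ σ (α' t)   = ⊩ₐ-≗ λ y k → sym (cong (genericα k) (evalT-substT (ρ y) σ t))
  Forces-substF⁺ p ρ σ ⊥'       h = h
  Forces-substF⁺ p ρ σ (φ ⇒ ψ)  h q q≼p x = Forces-substF⁺ q ρ σ ψ (h q q≼p (Forces-substF⁻ q ρ σ φ x))
  Forces-substF⁺ p ρ σ (∀' φ)   h f = Forces-substF⁺ p (f ∷ᴱ ρ) (liftσ σ) φ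
    (Forces-cong φ (λ y i → sym (evalT-liftσ (f y) (ρ y) σ i)) (h f))

ForcedEverywhere : Fm → Set
ForcedEverywhere φ = ∀ p ρ → Forces p ρ φ

Forces-sound : ∀ {Γ φ} → (∀ ψ → Γ ψ → ForcedEverywhere ψ) → Γ ⊢ φ → ForcedEverywhere φ
Forces-sound H (hyp Γψ)     p ρ = H _ Γψ p ρ
Forces-sound H (axK {φ})    p ρ q q≼p x r r≼q _ = Forces-≼ ρ φ r≼q x
Forces-sound H axS          p ρ q q≼p f r r≼q g s s≼r x =
  f s (≼-trans s≼r r≼q) x s ≼-refl (g s s≼r x)
Forces-sound H (axDN {φ})   p ρ q q≼p = Forces-¬¬-stable q ρ φ
Forces-sound H (mp d e)     p ρ = Forces-sound H d p ρ p ≼-refl (Forces-sound H e p ρ)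
Forces-sound H (axIn {φ} t) p ρ q q≼p h =
  Forces-substF⁺ q ρ (sub0 t) φ
    (Forces-cong φ (λ y i → sym (evalT-sub0 (ρ y) t i)) (h λ y → evalT (ρ y) t))
Forces-sound H (axQ {φ})    p ρ q q≼p h r r≼q x f =
  h f r r≼q (Forces-substF⁺ r (f ∷ᴱ ρ) (λ i → var (suc i)) φ x)
Forces-sound H (gen d)      p ρ f = Forces-sound H d p (f ∷ᴱ ρ)
Forces-sound H (axRef t)    p ρ = ⊩ₐ-⊆ λ y _ _ _ → ≡⇒≡ᵇ (evalT (ρ y) t) _ refl
Forces-sound H (axEq {φ} t s) p ρ q q≼p t≐s r r≼q x =
  Forces-substF⁺ r ρ (sub0 s) φ
    (Forces-agree φ (⊩ₐ-≼ r≼q t≐s) agree (Forces-substF⁻ r ρ (sub0 t) φ x))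
  where
  agree : Agree (holds ρ (eq t s)) (substᴱ ρ (sub0 t)) (substᴱ ρ (sub0 s))
  agree y k t≡s zero    = ≡ᵇ⇒≡ _ _ t≡s
  agree y k t≡s (suc i) = refl

private
  ∁⇒-⊆ˡ : ∀ u v → T (not (not u ∨ v)) → T u
  ∁⇒-⊆ˡ true _ _ = tt

  ∁⇒-⊆ʳ : ∀ u v → T (not (not u ∨ v)) → T (not v)
  ∁⇒-⊆ʳ true false _ = tt

  ⇒-mp : ∀ u v → T (not u ∨ v) → T u → T v
  ⇒-mp true true _ _ = tt

mutual
  Forces-QF⁻ : ∀ p ρ {θ} (q : QF θ) → Forces p ρ θ → p ⊩ₐ holds ρ q
  Forces-QF⁻ p ρ (eq t s)  h = h
  Forces-QF⁻ p ρ (lt t s)  h = h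
  Forces-QF⁻ p ρ (mem t)   h = h
  Forces-QF⁻ p ρ (imp a b) h = ⊩ₐ-dense λ r r≼p r⊆∁ →
    ⊩ₐ-∁ (λ y k k< x → ∁⇒-⊆ʳ (holds ρ a y k) (holds ρ b y k) (r⊆∁ y k k< x))
      (Forces-QF⁻ r ρ b (h r r≼p (Forces-QF⁺ r ρ a (⊩ₐ-⊆ λ y k k< x →
        ∁⇒-⊆ˡ (holds ρ a y k) (holds ρ b y k) (r⊆∁ y k k< x)))))

  Forces-QF⁺ : ∀ p ρ {θ} (q : QF θ) → p ⊩ₐ holds ρ q → Forces p ρ θ
  Forces-QF⁺ p ρ (eq t s)  h = h
  Forces-QF⁺ p ρ (lt t s)  h = h
  Forces-QF⁺ p ρ (mem t)   h = h
  Forces-QF⁺ p ρ bot       h = ⊩ₐ-Small (Small-empty λ _ _ _ ()) h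
  Forces-QF⁺ p ρ (imp a b) h r r≼p x = Forces-QF⁺ r ρ b
    (⊩ₐ-∩ (λ y k _ → ⇒-mp (holds ρ a y k) (holds ρ b y k)) (⊩ₐ-≼ r≼p h) (Forces-QF⁻ r ρ a x))

Forces-universal : ∀ n {θ} (q : QF θ) → (∀ α → Valid α (∀^ n θ)) → ForcedEverywhere (∀^ n θ)
Forces-universal zero    q valid p ρ =
  Forces-QF⁺ p ρ q (⊩ₐ-⊆ λ y k _ _ → Sat→evalQF (genericα k) (ρ y) q (valid (genericα k) (ρ y)))
Forces-universal (suc n) {θ} q valid p ρ f = Forces-universal n q valid′ p (f ∷ᴱ ρ)
  where
  valid′ : ∀ α → Valid α (∀^ n θ)
  valid′ α ρ = Sat-cong α (λ { zero → refl ; (suc i) → refl }) (∀^ n θ) (valid α (λ i → ρ (suc i)) (ρ 0))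

Forces-∧⁻ˡ : ∀ p ρ φ ψ → Forces p ρ (φ ∧' ψ) → Forces p ρ φ
Forces-∧⁻ˡ p ρ φ ψ h = Forces-¬¬-stable p ρ φ λ q q≼p ¬φ →
  h q q≼p λ r r≼q x s s≼r _ → ¬φ s (≼-trans s≼r r≼q) (Forces-≼ ρ φ s≼r x)

Forces-∧⁻ʳ : ∀ p ρ φ ψ → Forces p ρ (φ ∧' ψ) → Forces p ρ ψ
Forces-∧⁻ʳ p ρ φ ψ h = Forces-¬¬-stable p ρ ψ λ q q≼p ¬ψ →
  h q q≼p λ r r≼q _ s s≼r y → ¬ψ s (≼-trans s≼r r≼q) y

-- The maximum principle

largest-below : ∀ (P : ℕ → Bool) L w → w < L → P w ≡ true →
                Σ ℕ λ m → m < L × P m ≡ true × (∀ z → z < L → P z ≡ true → z ≤ m)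
largest-below P (suc L) w w<1+L Pw with P L in PL
... | true  = L , n<1+n L , PL , λ z z<1+L _ → ≤-pred z<1+L
... | false =
  let (m , m<L , Pm , largest) = largest-below P L w (below-L w w<1+L Pw) Pw
  in  m , m<n⇒m<1+n m<L , Pm , λ z z<1+L Pz → largest z (below-L z z<1+L Pz) Pz
  where
  below-L : ∀ z → z < suc L → P z ≡ true → z < L
  below-L z z<1+L Pz with m≤n⇒m<n∨m≡n (≤-pred z<1+L)
  ... | inj₁ z<L  = z<L
  ... | inj₂ refl with () ← trans (sym PL) Pz

module MaximumPrinciple (len : PVSym 1) (isLength : IsLength len) where

  ∣_∣ᵗ : Term → Term
  ∣ t ∣ᵗ = app len (t ∷ [])

  noLarger : Fm
  noLarger = (var 0 <' ∣ var 3 ∣ᵗ) ⇒ (α' (var 0) ⇒ ¬' (var 1 <' var 0))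

  noLarger-QF : QF noLarger
  noLarger-QF = imp (lt _ _) (imp (mem _) (imp (lt _ _) bot))

  isMaximum : Fm
  isMaximum = α' (var 0) ∧' ∀' noLarger

  maximumBelow : Fm
  maximumBelow = (var 0 <' ∣ var 2 ∣ᵗ) ∧' isMaximum

  -- ∀y ∀w. α(w) → w < |y| → ∃m < |y|. α(m) ∧ ∀z < |y|. α(z) → ¬ m < z
  maxPrinciple : Fm
  maxPrinciple = ∀' (∀' (α' (var 0) ⇒ ((var 0 <' ∣ var 1 ∣ᵗ) ⇒ ∃' maximumBelow)))

  maxPrinciple-valid : ∀ α → Sat α (λ _ → 0) maxPrinciple
  maxPrinciple-valid α y w αw w<∣y∣ noMaximum =
    let (m , m<∣y∣ , αm , largest) = largest-below α (interp len (y ∷ [])) w w<∣y∣ αw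
    in  noMaximum m λ k → k m<∣y∣ λ k′ → k′ αm λ z z<∣y∣ αz m<z →
          <⇒≱ m<z (largest z z<∣y∣ αz)

  maxPrinciple-∈ThΔ : ThΔ maxPrinciple
  maxPrinciple-∈ThΔ = record
    { n     = 2
    ; ψ     = _
    ; isΔ   = imp (mem _) (imp (lt _ _) (bex len isLength (var 1)
                (imp (imp (mem _) (imp (ball len isLength (var 2)
                  (imp (mem _) (imp (lt _ _) bot))) bot)) bot)))
    ; below = b , (b , b , _) , ((((b , b , _) , ((b , ((b , b , _) , b , (b , b) , _) , _) , _) , _) , _) , _) , _
    ; clos  = refl
    ; holds = maxPrinciple-valid
    }
    where
    b : ∀ {m n} {_ : T (m <ᵇ n)} → m < n
    b {m} {n} {m<n} = <ᵇ⇒< m n m<n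

  full : Condition
  full = condition (λ _ _ → true) ¬Small-full

  maxPrinciple-not-forced : ∀ ρ → ¬ Forces full ρ maxPrinciple
  maxPrinciple-not-forced ρ forced =
    forced (λ y → y) (λ _ → 0) full ≼-refl 0∈α full ≼-refl 0<∣y∣ full ≼-refl no-maximum
    where
    ρ₂ : Env
    ρ₂ = (λ _ → 0) ∷ᴱ ((λ y → y) ∷ᴱ ρ)

    0∈α : Forces full ρ₂ (α' (var 0))
    0∈α = ⊩ₐ-⊆ λ _ _ _ _ → tt

    0<∣y∣ : Forces full ρ₂ (var 0 <' ∣ var 1 ∣ᵗ)
    0<∣y∣ = ⊩ₐ-⊆ λ y k k<∣y∣ _ →
      <⇒<ᵇ (subst (0 <_) (sym (isLength y)) (≤-<-trans z≤n k<∣y∣))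

    no-maximum : Forces full ρ₂ (∀' (¬' maximumBelow))
    -- A maximum f forced by q equals k at almost all positions (y, k) of q,
    -- but the graph of f is small.
    no-maximum f q _ forcedMax = ⊩ₐ-Small (Small-graph f) (⊩ₐ-∩ f-is-k f∈α noneLarger)
      where
      ρ₃ = f ∷ᴱ ρ₂
      ρ₄ = (λ y → suc (f y)) ∷ᴱ ρ₃
      max : Forces q ρ₃ isMaximum
      max = Forces-∧⁻ʳ q ρ₃ (var 0 <' ∣ var 2 ∣ᵗ) isMaximum forcedMax
      f∈α : q ⊩ₐ holds ρ₃ (mem (var 0))
      f∈α = Forces-∧⁻ˡ q ρ₃ (α' (var 0)) (∀' noLarger) max
      noneLarger : q ⊩ₐ holds ρ₄ noLarger-QF
      noneLarger = Forces-QF⁻ q ρ₄ noLarger-QF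
        (Forces-∧⁻ʳ q ρ₃ (α' (var 0)) (∀' noLarger) max (λ y → suc (f y)))
      f-is-k : ∀ y k → k < size y → T (holds ρ₃ (mem (var 0)) y k) → T (holds ρ₄ noLarger-QF y k) →
               T (f y ≡ᵇ k)
      f-is-k y k k<∣y∣ fy≤k noneLarger-at with m≤n⇒m<n∨m≡n (≤ᵇ⇒≤ _ _ fy≤k)
      ... | inj₂ fy≡k = ≡⇒≡ᵇ _ _ fy≡k
      ... | inj₁ fy<k = ⊥-elim (evalQF→Sat (genericα k) (ρ₄ y) noLarger-QF noneLarger-at
              (subst (suc (f y) <_) (sym (isLength y)) (≤-<-trans fy<k k<∣y∣))
              (Equivalence.to T-≡ (≤⇒≤ᵇ fy<k))
              ≤-refl)

-- A polynomial-time machine computing |x|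

pattern start = zero
pattern skip  = suc zero
pattern carry = suc (suc zero)
pattern back  = suc (suc (suc zero))
pattern halt  = suc (suc (suc (suc zero)))

-- Each round erases the first remaining input bit (start), skips the rest of the
-- input (skip), increments a binary counter, least significant bit first, kept
-- right of the separator (carry), and returns to the erased cell (back).
δ : Fin 5 → Sym → Maybe (Fin 5 × Sym × Move)
δ start sep   = just (halt , sep , right)
δ start _     = just (skip , blank , right)
δ skip  sep   = just (carry , sep , right)
δ skip  s     = just (skip , s , right)
δ carry b1    = just (carry , b0 , right)
δ carry _     = just (back , b1 , left)
δ back  blank = just (start , blank , right)
δ back  s     = just (back , s , left)
δ halt  _     = nothing

lengthMachine : TM
lengthMachine = record { Q = 5 ; start = start ; δ = δ }

Cfg : Set
Cfg = Config lengthMachine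

data Steps : Cfg → ℕ → Cfg → Set where
  done : ∀ {c} → Steps c 0 c
  step : ∀ {q l r q′ s m n c} → δ q (headSym r) ≡ just (q′ , s , m) →
         Steps (q′ , moveHead m s l r) n c → Steps (q , l , r) (suc n) c

Steps-run : ∀ {c n c′} → Steps c n c′ → ∀ f → run lengthMachine (n + f) c ≡ run lengthMachine f c′
Steps-run done                   f = refl
Steps-run (step e s)             f rewrite e = Steps-run s f

_▸_ : ∀ {a n b m c} → Steps a n b → Steps b m c → Steps a (n + m) c
done     ▸ t = t
step e s ▸ t = step e (s ▸ t)

data IsBit : Sym → Set where
  b0 : IsBit b0
  b1 : IsBit b1

data NonBlank : Sym → Set where
  b0  : NonBlank b0
  b1  : NonBlank b1
  sep : NonBlank sep

IsBit⇒NonBlank : ∀ {s} → IsBit s → NonBlank s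
IsBit⇒NonBlank b0 = b0
IsBit⇒NonBlank b1 = b1

All-ʳ++⁺ : ∀ {P : Sym → Set} {xs ys} → All P xs → All P ys → All P (xs ʳ++ ys)
All-ʳ++⁺ []       pys = pys
All-ʳ++⁺ (p ∷ ps) pys = All-ʳ++⁺ ps (p ∷ pys)

δ-skip-bit : ∀ {s} → IsBit s → δ skip s ≡ just (skip , s , right)
δ-skip-bit b0 = refl
δ-skip-bit b1 = refl

δ-start-bit : ∀ {s} → IsBit s → δ start s ≡ just (skip , blank , right)
δ-start-bit b0 = refl
δ-start-bit b1 = refl

δ-back-nonBlank : ∀ {s} → NonBlank s → δ back s ≡ just (back , s , left)
δ-back-nonBlank b0  = refl
δ-back-nonBlank b1  = refl
δ-back-nonBlank sep = refl

skip-bits : ∀ w u l R → All IsBit w →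
            Steps (skip , u ++ blank ∷ l , w ++ R) (length w) (skip , (w ʳ++ u) ++ blank ∷ l , R)
skip-bits []      u l R []           = done
skip-bits (s ∷ w) u l R (bit ∷ bits) = step (δ-skip-bit bit) (skip-bits w (s ∷ u) l R bits)

return-left : ∀ u s l R → All NonBlank u →
              Steps (back , moveHead left s (u ++ blank ∷ l) R) (suc (length u))
                    (start , blank ∷ l , u ʳ++ s ∷ tailSym R)
return-left []      s l R []       = step refl done
return-left (a ∷ u) s l R (na ∷ nu) = step (δ-back-nonBlank na) (return-left u a l (a ∷ s ∷ tailSym R) nu)

counter : List Bool → List Sym
counter []          = []
counter (false ∷ c) = b0 ∷ counter c
counter (true ∷ c)  = b1 ∷ counter c

inc : List Bool → List Bool
inc []          = true ∷ []
inc (false ∷ c) = true ∷ c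
inc (true ∷ c)  = false ∷ inc c

incrementSteps : List Bool → ℕ → ℕ
incrementSteps (true ∷ c) u = suc (incrementSteps c (suc u))
incrementSteps _          u = suc (suc u)

increment : ∀ c u l → All NonBlank u →
            Steps (carry , u ++ blank ∷ l , counter c) (incrementSteps c (length u))
                  (start , blank ∷ l , u ʳ++ counter (inc c))
increment []          u l nu = step refl (return-left u b1 l [] nu)
increment (false ∷ c) u l nu = step refl (return-left u b1 l (b0 ∷ counter c) nu)
increment (true ∷ c)  u l nu = step refl (increment c (b0 ∷ u) l (b0 ∷ nu))

roundSteps : List Sym → List Bool → ℕ
roundSteps rest c = suc (length rest + suc (incrementSteps c (suc (length (rest ʳ++ [])))))

round : ∀ s rest l c → IsBit s → All IsBit rest →
        Steps (start , l , (s ∷ rest) ++ sep ∷ counter c) (roundSteps rest c)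
              (start , blank ∷ l , rest ++ sep ∷ counter (inc c))
round s rest l c bit bits =
  subst (Steps _ _) (cong (λ t → start , blank ∷ l , t) (ʳ++-ʳ++ rest))
    (step (δ-start-bit bit) (skip-bits rest [] l (sep ∷ counter c) bits
      ▸ step refl (increment c (sep ∷ rest ʳ++ []) l (sep ∷ All-ʳ++⁺ (All.map IsBit⇒NonBlank bits) []))))

incⁿ : ℕ → List Bool → List Bool
incⁿ zero    c = c
incⁿ (suc n) c = incⁿ n (inc c)

roundsSteps : List Sym → List Bool → ℕ
roundsSteps []         c = 0
roundsSteps (_ ∷ rest) c = roundSteps rest c + roundsSteps rest (inc c)

rounds : ∀ w l c → All IsBit w →
         Σ (List Sym) λ l′ → Steps (start , l , w ++ sep ∷ counter c) (roundsSteps w c)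
                                   (start , l′ , sep ∷ counter (incⁿ (length w) c))
rounds []       l c []           = l , done
rounds (s ∷ w) l c (bit ∷ bits) =
  let (l′ , steps) = rounds w (blank ∷ l) (inc c) bits
  in  l′ , round s w l c bit bits ▸ steps

length-inc : ∀ c → length (inc c) ≤ suc (length c)
length-inc []          = ≤-refl
length-inc (false ∷ c) = n≤1+n _
length-inc (true ∷ c)  = s≤s (length-inc c)

incrementSteps-≤ : ∀ c u → incrementSteps c u ≤ 2 + u + 2 * length c
incrementSteps-≤ []          u = s≤s (s≤s (m≤m+n u 0))
incrementSteps-≤ (false ∷ c) u = s≤s (s≤s (m≤m+n u _))
incrementSteps-≤ (true ∷ c)  u =
  ≤-trans (s≤s (incrementSteps-≤ c (suc u))) (≤-reflexive (arith u (length c)))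
  where
  arith : ∀ u c → suc (2 + suc u + 2 * c) ≡ 2 + u + 2 * suc c
  arith = solve-∀

roundSteps-≤ : ∀ rest c → roundSteps rest c ≤ 3 + 2 * (suc (length rest) + length c)
roundSteps-≤ rest c = begin
  suc (r + suc (incrementSteps c (suc (length (rest ʳ++ [])))))
    ≤⟨ s≤s (+-monoʳ-≤ r (s≤s (incrementSteps-≤ c _))) ⟩
  suc (r + suc (2 + suc (length (rest ʳ++ [])) + 2 * length c))
    ≡⟨ cong (λ n → suc (r + suc (2 + suc n + 2 * length c))) (length-ʳ++ rest) ⟩
  suc (r + suc (2 + suc (r + 0) + 2 * length c))
    ≡⟨ arith r (length c) ⟩
  3 + 2 * (suc r + length c)
    ∎
  where
  open ≤-Reasoning
  r = length rest
  arith : ∀ r c → suc (r + suc (2 + suc (r + 0) + 2 * c)) ≡ 3 + 2 * (suc r + c)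
  arith = solve-∀

roundsSteps-≤ : ∀ w c m → length w + length c ≤ m → roundsSteps w c ≤ length w * (3 + 2 * m)
roundsSteps-≤ []      c m _ = z≤n
roundsSteps-≤ (_ ∷ w) c m h = +-mono-≤
  (≤-trans (roundSteps-≤ w c) (+-monoʳ-≤ 3 (*-monoʳ-≤ 2 h)))
  (roundsSteps-≤ w (inc c) m (≤-trans (+-monoʳ-≤ (length w) (length-inc c))
                                      (≤-trans (≤-reflexive (+-suc (length w) (length c))) h)))

div2 : ∀ n → n / 2 ≡ ⌊ n /2⌋
div2 zero          = refl
div2 (suc zero)    = refl
div2 (suc (suc n)) = trans (m/n≡1+[m∸n]/n {suc (suc n)} {2} (s≤s (s≤s z≤n))) (cong suc (div2 n))

size-suc : ∀ x → size (suc x) ≡ suc (size ⌊ suc x /2⌋)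
size-suc x = cong suc (⌈log2⌉-acc-irrelevant (suc ⌊ suc x /2⌋))

bitsAux-IsBit : ∀ f n → All IsBit (bitsAux f n)
bitsAux-IsBit zero    n = []
bitsAux-IsBit (suc f) n with n ≡ᵇ 0
... | true = []
... | false with n % 2 ≡ᵇ 0
...   | true  = b0 ∷ bitsAux-IsBit f (n / 2)
...   | false = b1 ∷ bitsAux-IsBit f (n / 2)

length-bitsAux-suc : ∀ f x → length (bitsAux (suc f) (suc x)) ≡ suc (length (bitsAux f (suc x / 2)))
length-bitsAux-suc f x with suc x % 2 ≡ᵇ 0
... | true  = refl
... | false = refl

length-bitsAux : ∀ f x → x ≤ f → length (bitsAux f x) ≡ size x
length-bitsAux zero    zero    _         = refl
length-bitsAux (suc f) zero    _         = refl
length-bitsAux (suc f) (suc x) (s≤s x≤f) = begin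
  length (bitsAux (suc f) (suc x))     ≡⟨ length-bitsAux-suc f x ⟩
  suc (length (bitsAux f (suc x / 2))) ≡⟨ cong suc (length-bitsAux f (suc x / 2) half≤f) ⟩
  suc (size (suc x / 2))               ≡⟨ cong (λ h → suc (size h)) (div2 (suc x)) ⟩
  suc (size ⌊ suc x /2⌋)               ≡⟨ sym (size-suc x) ⟩
  size (suc x)                         ∎
  where
  open ≡-Reasoning
  half≤f : suc x / 2 ≤ f
  half≤f = ≤-trans (≤-pred (m/n<m (suc x) 2 (s≤s (s≤s z≤n)))) x≤f

decode-counter-inc : ∀ c → decode (counter (inc c)) ≡ suc (decode (counter c))
decode-counter-inc []          = refl
decode-counter-inc (false ∷ c) = refl
decode-counter-inc (true ∷ c)  = trans (cong (2 *_) (decode-counter-inc c)) (*-suc 2 _)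

decode-counter-incⁿ : ∀ n c → decode (counter (incⁿ n c)) ≡ n + decode (counter c)
decode-counter-incⁿ zero    c = refl
decode-counter-incⁿ (suc n) c =
  trans (decode-counter-incⁿ n (inc c)) (trans (cong (n +_) (decode-counter-inc c)) (+-suc n _))

bits-steps : ℕ → ℕ
bits-steps x = roundsSteps (bits x) [] + 1

lengthMachine-halts : ∀ x f → run lengthMachine (bits-steps x + f) (initConfig lengthMachine (x ∷ [])) ≡
                              just (counter (incⁿ (length (bits x)) []))
lengthMachine-halts x f =
  let (_ , steps) = rounds (bits x) [] [] (bitsAux-IsBit x x)
  in  Steps-run (steps ▸ step refl done) f

bits-steps-≤ : ∀ x → bits-steps x ≤ clock 3 2 (length (encode (x ∷ [])))
bits-steps-≤ x = begin
  roundsSteps (bits x) [] + 1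
    ≤⟨ +-monoˡ-≤ 1 (roundsSteps-≤ (bits x) [] n (≤-reflexive (+-identityʳ n))) ⟩
  n * (3 + 2 * n) + 1
    ≤⟨ m≤m+n _ (n * n + 9 * n + 11) ⟩
  n * (3 + 2 * n) + 1 + (n * n + 9 * n + 11)
    ≡⟨ arith n ⟩
  3 * (suc (n + 1) * (suc (n + 1) * 1))
    ≡⟨ cong (λ L → 3 * (suc L * (suc L * 1))) (sym (length-++ (bits x))) ⟩
  clock 3 2 (length (encode (x ∷ [])))
    ∎
  where
  open ≤-Reasoning
  n = length (bits x)
  arith : ∀ n → n * (3 + 2 * n) + 1 + (n * n + 9 * n + 11) ≡ 3 * (suc (n + 1) * (suc (n + 1) * 1))
  arith = solve-∀

lengthMachine-computes : ∀ x →
  run lengthMachine (clock 3 2 (length (encode (x ∷ [])))) (initConfig lengthMachine (x ∷ [])) ≡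
  just (counter (incⁿ (length (bits x)) []))
lengthMachine-computes x =
  trans (cong (λ t → run lengthMachine t (initConfig lengthMachine (x ∷ [])))
              (sym (m+[n∸m]≡n (bits-steps-≤ x))))
        (lengthMachine-halts x _)

lengthSym : PVSym 1
lengthSym = record
  { machine = lengthMachine
  ; c       = 3
  ; d       = 2
  ; poly    = λ { (x ∷ []) → subst Is-just (sym (lengthMachine-computes x)) (just tt) }
  }

lengthSym-isLength : IsLength lengthSym
lengthSym-isLength x = begin
  maybe′ decode 0 (run lengthMachine _ (initConfig lengthMachine (x ∷ [])))
    ≡⟨ cong (maybe′ decode 0) (lengthMachine-computes x) ⟩
  decode (counter (incⁿ (length (bits x)) []))
    ≡⟨ decode-counter-incⁿ (length (bits x)) [] ⟩
  length (bits x) + 0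
    ≡⟨ +-identityʳ _ ⟩
  length (bits x)
    ≡⟨ length-bitsAux x x ≤-refl ⟩
  size x
    ∎
  where open ≡-Reasoning

proposition2p4 : ¬ (Σ (Fm → Set) λ T → ((φ : Fm) → T φ → UniversalSentence φ) × Equivalent ThΔ T)
proposition2p4 (T , universal , T⊢ThΔ , ThΔ⊢T) =
  maxPrinciple-not-forced ρ₀ (Forces-sound T-forced (T⊢ThΔ maxPrinciple maxPrinciple-∈ThΔ) full ρ₀)
  where
  open MaximumPrinciple lengthSym lengthSym-isLength
  ρ₀ : Env
  ρ₀ _ _ = 0
  T-forced : ∀ U → T U → ForcedEverywhere U
  T-forced U TU with universal U TU
  ... | n , _ , qf , _ , refl = Forces-universal n qf λ α → ⊢-sound α (ThΔ-valid α) (ThΔ⊢T _ TU)
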